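{- Let $\mathcal{A}\subseteq\mathcal{P}[n]$, let $G$ be the induced subgraph of $Q_n$ on vertex set $\mathcal{A}$, and let $i\in\{1,\dots,n\}$. Suppose $G$ has average degree at least $d$ and any two vertices of $G$ are at Hamming distance less than $k$. Then the induced subgraph $G'$ of $Q_n$ on vertex set $C_i(\mathcal{A})$ also has average degree at least $d$ and any two of its vertices are at Hamming distance less than $k$.
   Context: Vertices of $Q_n$ are identified with subsets of $[n]=\{1,\dots,n\}$, two subsets being adjacent if their symmetric difference has exactly one element; the Hamming distance of $A,B$ is $|A\triangle B|$. For $A\subseteq[n]$, $C_i(A)=A\setminus\{i\}$ if $i\in A$ and $C_i(A)=A$ otherwise. For $\mathcal{A}\subseteq\mathcal{P}[n]$, the down-compression is $C_i(\mathcal{A})=\{C_i(A):A\in\mathcal{A}\}\cup\{A\in\mathcal{A}: C_i(A)\in\mathcal{A}\}$ (so each $A\in\mathcal{A}$ is replaced by $A\setminus\{i\}$ unless the latter already lies in $\mathcal{A}$, and $|C_i(\mathcal{A})|=|\mathcal{A}|$).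
   Formalization: The bound d on the average degree, in both the hypothesis on G and the conclusion on G′, is rational. -}

module Defs where

open import Data.Nat using (ℕ; _<_)
open import Data.Bool using (if_then_else_)
open import Data.Bool.Properties using () renaming (_≟_ to _≟ᵇ_)
open import Data.Fin using (Fin)
open import Data.Fin.Subset using (Subset; _∪_; _─_; _-_; ∣_∣)
open import Data.List using (List; map; filter; length)
open import Data.Nat.ListAction using (sum)
open import Data.List.Membership.Propositional using (_∈_)
import Data.List.Membership.DecPropositional as DecMem
open import Data.Vec.Properties using (≡-dec)
open import Data.Integer using (+_)
open import Data.Rational using (ℚ; _/_; _*_; _≤_)
open import Relation.Nullary.Decidable using (does)
open import Relation.Binary.PropositionalEquality using (_≡_)
open import Relation.Binary.Definitions using (DecidableEquality)
import Data.Nat as ℕ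

-- Vertices of Q_n: subsets of [n], represented as Subset n = Vec Bool n
-- (position j ↔ element j+1 of [n]).

_≟ˢ_ : ∀ {n} → DecidableEquality (Subset n)
_≟ˢ_ = ≡-dec _≟ᵇ_

hamming : ∀ {n} → Subset n → Subset n → ℕ
hamming A B = ∣ (A ─ B) ∪ (B ─ A) ∣

Cᵢ : ∀ {n} → Fin n → Subset n → Subset n
Cᵢ i A = A - i

-- Down-compression of a family given as a duplicate-free list:
-- each A is replaced by C_i(A) unless C_i(A) already lies in 𝒜.
compress : ∀ {n} → Fin n → List (Subset n) → List (Subset n)
compress {n} i 𝒜 = map step 𝒜
  where
  open DecMem (_≟ˢ_ {n}) using (_∈?_)
  step : Subset n → Subset n
  step A = if does (Cᵢ i A ∈? 𝒜) then A else Cᵢ i A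

degree : ∀ {n} → List (Subset n) → Subset n → ℕ
degree 𝒜 A = length (filter (λ B → hamming A B ℕ.≟ 1) 𝒜)

degreeSum : ∀ {n} → List (Subset n) → ℕ
degreeSum 𝒜 = sum (map (degree 𝒜) 𝒜)

-- "G[𝒜] has average degree at least d":  degreeSum / |𝒜| ≥ d,
-- written multiplicatively as d · |𝒜| ≤ degreeSum (|𝒜| > 0 case;
-- vacuous for the empty family, where the average is undefined).
AvgDegreeAtLeast : ∀ {n} → List (Subset n) → ℚ → Set
AvgDegreeAtLeast 𝒜 d = d * ((+ length 𝒜) / 1) ≤ ((+ degreeSum 𝒜) / 1)

DiameterBelow : ∀ {n} → List (Subset n) → ℕ → Set
DiameterBelow 𝒜 k = ∀ {A B} → A ∈ 𝒜 → B ∈ 𝒜 → hamming A B < k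

module Submission where

-- Call A ∈ 𝒜 staying if C_i(A) ∈ 𝒜 (so A is kept) and moving otherwise.
--
-- Distances: if A and B both stay they are unchanged, if both move they both contain i and
-- d(A - i, B - i) = d(A, B). If A moves and B stays, either i ∉ B and d(A - i, B) ≤ d(A, B), or
-- i ∈ B and d(A - i, B) = d(A, B - i), where B - i ∈ 𝒜 because B stays.
--
-- Degrees: the degree sum counts ordered adjacent pairs of 𝒜, and that of C_i(𝒜) counts the
-- ordered pairs of 𝒜 whose images are adjacent; we inject the former into the latter. An edge AB
-- with both ends staying is kept. Otherwise both ends contain i (a neighbour of a moving set that
-- misses i is its compression, already in 𝒜), and a staying end whose partner moves is replaced by
-- its compression, which lies in 𝒜 and stays; the images of the new pair are A - i and B - i, still
-- adjacent. The replacement preserves whether each end stays, which makes the map injective.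

open import Defs
open import Data.Bool using (Bool; true; false; if_then_else_; _∧_; not)
open import Data.Bool.Properties using (∧-comm)
open import Data.Empty using (⊥-elim)
open import Data.Fin using (Fin; zero; suc)
open import Data.Fin.Subset using (Subset; _─_; _-_; ∣_∣; ⁅_⁆)
  renaming (_∈_ to _∈ˢ_; _∉_ to _∉ˢ_)
open import Data.Fin.Subset.Properties using (p─⊥≡p; p─q─q≡p─q; ∪-comm)
  renaming (_∈?_ to _∈ˢ?_)
open import Data.Integer using (+_; +≤+)
import Data.Integer.Properties as ℤ
open import Data.List using (List; []; _∷_; _++_; map; filter; length; cartesianProduct)
open import Data.List.Properties using (length-map; length-++; length-++-sucʳ; filter-++; map-∘; map-cong)
open import Data.List.Membership.Propositional using (_∈_; _∉_)
open import Data.List.Membership.Propositional.Properties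
  using (∈-∃++; ∈-filter⁺; ∈-filter⁻; ∈-cartesianProduct⁺; ∈-cartesianProduct⁻; ∈-map⁻)
import Data.List.Membership.DecPropositional as DecMembership
open import Data.List.Relation.Unary.Any using (here; there)
import Data.List.Relation.Unary.All as All
open import Data.List.Relation.Unary.AllPairs using (_∷_)
open import Data.List.Relation.Unary.Unique.Propositional using (Unique)
import Data.List.Relation.Unary.Unique.Propositional.Properties as Unique
open import Data.Nat using (ℕ; suc; _+_; _≤_; _<_; _≟_; z≤n; s≤s)
open import Data.Nat.ListAction using (sum)
open import Data.Nat.Properties using (≤-reflexive; ≤-<-trans; m≤n⇒m≤1+n; suc-injective; module ≤-Reasoning)
open import Data.Nat.Coprimality using (1-coprimeTo)
import Data.Nat.Coprimality as Coprimality
open import Data.Product using (_×_; _,_; proj₁; proj₂; swap)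
open import Data.Rational using (ℚ; *≤*) renaming (_≤_ to _≤ℚ_; _/_ to _/ℚ_)
import Data.Rational.Properties as ℚ
open import Data.Vec using ([]; _∷_; here; there)
open import Data.Vec.Properties using (∷-injectiveˡ; ∷-injectiveʳ)
open import Function using (_∘_; id)
open import Relation.Binary.PropositionalEquality
  using (_≡_; _≢_; refl; sym; trans; cong; cong₂; subst; subst₂; module ≡-Reasoning)
open import Relation.Nullary using (Dec; yes; no; does)
open import Relation.Nullary.Decidable using (dec-true)

private variable
  n : ℕ
  x : Fin n
  p q : Subset n

hamming-sym : ∀ (p q : Subset n) → hamming p q ≡ hamming q p
hamming-sym p q = cong ∣_∣ (∪-comm (p ─ q) (q ─ p))

hamming≡0⇒≡ : ∀ (p q : Subset n) → hamming p q ≡ 0 → p ≡ q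
hamming≡0⇒≡ []          []          _  = refl
hamming≡0⇒≡ (true  ∷ p) (true  ∷ q) eq = cong (true ∷_) (hamming≡0⇒≡ p q eq)
hamming≡0⇒≡ (false ∷ p) (false ∷ q) eq = cong (false ∷_) (hamming≡0⇒≡ p q eq)
hamming≡0⇒≡ (true  ∷ p) (false ∷ q) ()
hamming≡0⇒≡ (false ∷ p) (true  ∷ q) ()

hamming-∷-cong : ∀ a b {p q p′ q′ : Subset n} → hamming p q ≡ hamming p′ q′ →
                 hamming (a ∷ p) (b ∷ q) ≡ hamming (a ∷ p′) (b ∷ q′)
hamming-∷-cong true  true  eq = eq
hamming-∷-cong true  false eq = cong suc eq
hamming-∷-cong false true  eq = cong suc eq
hamming-∷-cong false false eq = eq

hamming-∷-mono-≤ : ∀ a b {p q p′ q′ : Subset n} → hamming p q ≤ hamming p′ q′ →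
                   hamming (a ∷ p) (b ∷ q) ≤ hamming (a ∷ p′) (b ∷ q′)
hamming-∷-mono-≤ true  true  le = le
hamming-∷-mono-≤ true  false le = s≤s le
hamming-∷-mono-≤ false true  le = s≤s le
hamming-∷-mono-≤ false false le = le

x∉p⇒p-x≡p : x ∉ˢ p → p - x ≡ p
x∉p⇒p-x≡p {x = zero}  {p = true  ∷ p} x∉p = ⊥-elim (x∉p here)
x∉p⇒p-x≡p {x = zero}  {p = false ∷ p} _   = cong (false ∷_) (p─⊥≡p p)
x∉p⇒p-x≡p {x = suc x} {p = a     ∷ p} x∉p = cong (a ∷_) (x∉p⇒p-x≡p (x∉p ∘ there))

p-x-injective : x ∈ˢ p → x ∈ˢ q → p - x ≡ q - x → p ≡ q
p-x-injective {p = _ ∷ p} {q = _ ∷ q} here here eq =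
  cong (true ∷_) (trans (sym (p─⊥≡p p)) (trans (∷-injectiveʳ eq) (p─⊥≡p q)))
p-x-injective (there x∈p) (there x∈q) eq =
  cong₂ _∷_ (∷-injectiveˡ eq) (p-x-injective x∈p x∈q (∷-injectiveʳ eq))

x∈p∧x∈q⇒hamming[p-x,q-x]≡hamming[p,q] : x ∈ˢ p → x ∈ˢ q →
                                         hamming (p - x) (q - x) ≡ hamming p q
x∈p∧x∈q⇒hamming[p-x,q-x]≡hamming[p,q] {p = _ ∷ p} {q = _ ∷ q} here here =
  cong₂ hamming (p─⊥≡p p) (p─⊥≡p q)
x∈p∧x∈q⇒hamming[p-x,q-x]≡hamming[p,q] {x = suc x} {p = a ∷ p} {q = b ∷ q} (there x∈p) (there x∈q) =
  hamming-∷-cong a b {p - x} {q - x} {p} {q} (x∈p∧x∈q⇒hamming[p-x,q-x]≡hamming[p,q] x∈p x∈q)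

x∈p∧x∈q⇒hamming[p-x,q]≡hamming[p,q-x] : x ∈ˢ p → x ∈ˢ q →
                                         hamming (p - x) q ≡ hamming p (q - x)
x∈p∧x∈q⇒hamming[p-x,q]≡hamming[p,q-x] {p = _ ∷ p} {q = _ ∷ q} here here =
  cong suc (cong₂ hamming (p─⊥≡p p) (sym (p─⊥≡p q)))
x∈p∧x∈q⇒hamming[p-x,q]≡hamming[p,q-x] {x = suc x} {p = a ∷ p} {q = b ∷ q} (there x∈p) (there x∈q) =
  hamming-∷-cong a b {p - x} {q} {p} {q - x} (x∈p∧x∈q⇒hamming[p-x,q]≡hamming[p,q-x] x∈p x∈q)

x∉q⇒hamming[p-x,q]≤hamming[p,q] : x ∉ˢ q → hamming (p - x) q ≤ hamming p q
x∉q⇒hamming[p-x,q]≤hamming[p,q] {x = zero}  {q = true  ∷ q}              x∉q = ⊥-elim (x∉q here)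
x∉q⇒hamming[p-x,q]≤hamming[p,q] {x = zero}  {q = false ∷ q} {true  ∷ p} _   =
  m≤n⇒m≤1+n (≤-reflexive (cong (λ r → hamming r q) (p─⊥≡p p)))
x∉q⇒hamming[p-x,q]≤hamming[p,q] {x = zero}  {q = false ∷ q} {false ∷ p} _   =
  ≤-reflexive (cong (λ r → hamming r q) (p─⊥≡p p))
x∉q⇒hamming[p-x,q]≤hamming[p,q] {x = suc x} {q = b ∷ q}     {a ∷ p}     x∉q =
  hamming-∷-mono-≤ a b {p - x} {q} {p} {q} (x∉q⇒hamming[p-x,q]≤hamming[p,q] {p = p} (x∉q ∘ there))

x∈p∧x∉q∧hamming[p,q]≡1⇒q≡p-x : x ∈ˢ p → x ∉ˢ q → hamming p q ≡ 1 → q ≡ p - x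
x∈p∧x∉q∧hamming[p,q]≡1⇒q≡p-x {q = true ∷ q} here x∉q _ = ⊥-elim (x∉q here)
x∈p∧x∉q∧hamming[p,q]≡1⇒q≡p-x {p = _ ∷ p} {q = false ∷ q} here _ eq =
  cong (false ∷_) (trans (sym (hamming≡0⇒≡ p q (suc-injective eq))) (sym (p─⊥≡p p)))
x∈p∧x∉q∧hamming[p,q]≡1⇒q≡p-x {p = true ∷ p} {q = true ∷ q} (there x∈p) x∉q eq =
  cong (true ∷_) (x∈p∧x∉q∧hamming[p,q]≡1⇒q≡p-x x∈p (x∉q ∘ there) eq)
x∈p∧x∉q∧hamming[p,q]≡1⇒q≡p-x {p = false ∷ p} {q = false ∷ q} (there x∈p) x∉q eq =
  cong (false ∷_) (x∈p∧x∉q∧hamming[p,q]≡1⇒q≡p-x x∈p (x∉q ∘ there) eq)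
x∈p∧x∉q∧hamming[p,q]≡1⇒q≡p-x {p = true ∷ p} {q = false ∷ q} (there x∈p) x∉q eq =
  ⊥-elim (x∉q (there (subst (_ ∈ˢ_) (hamming≡0⇒≡ p q (suc-injective eq)) x∈p)))
x∈p∧x∉q∧hamming[p,q]≡1⇒q≡p-x {p = false ∷ p} {q = true ∷ q} (there x∈p) x∉q eq =
  ⊥-elim (x∉q (there (subst (_ ∈ˢ_) (hamming≡0⇒≡ p q (suc-injective eq)) x∈p)))

∈-++-∷⁻ : ∀ {A : Set} {v w : A} xs ys → v ∈ xs ++ w ∷ ys → v ≢ w → v ∈ xs ++ ys
∈-++-∷⁻ []       ys (here v≡w) v≢w = ⊥-elim (v≢w v≡w)
∈-++-∷⁻ []       ys (there v∈) _   = v∈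
∈-++-∷⁻ (x ∷ xs) ys (here v≡x) _   = here v≡x
∈-++-∷⁻ (x ∷ xs) ys (there v∈) v≢w = there (∈-++-∷⁻ xs ys v∈ v≢w)

injection⇒length-≤ : ∀ {A B : Set} (f : A → B) {xs ys} → Unique xs →
                     (∀ {x} → x ∈ xs → f x ∈ ys) →
                     (∀ {x y} → x ∈ xs → y ∈ xs → f x ≡ f y → x ≡ y) →
                     length xs ≤ length ys
injection⇒length-≤ f {[]}     _              _    _   = z≤n
injection⇒length-≤ f {x ∷ xs} (x∉xs ∷ uniq) into inj
  with ys₁ , ys₂ , refl ← ∈-∃++ (into (here refl)) =
  subst (suc (length xs) ≤_) (sym (length-++-sucʳ ys₁ (f x) ys₂))
    (s≤s (injection⇒length-≤ f uniq into′ (λ u v → inj (there u) (there v))))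
  where
  into′ : ∀ {z} → z ∈ xs → f z ∈ ys₁ ++ ys₂
  into′ z∈xs = ∈-++-∷⁻ ys₁ ys₂ (into (there z∈xs))
    (λ fz≡fx → All.lookup x∉xs z∈xs (inj (here refl) (there z∈xs) (sym fz≡fx)))

length-filter-map : ∀ {A B : Set} {P : B → Set} (P? : ∀ y → Dec (P y)) (f : A → B) xs →
                    length (filter P? (map f xs)) ≡ length (filter (P? ∘ f) xs)
length-filter-map P? f []       = refl
length-filter-map P? f (x ∷ xs) with does (P? (f x))
... | true  = cong suc (length-filter-map P? f xs)
... | false = length-filter-map P? f xs

length-filter-cartesianProduct :
  ∀ {A B : Set} {R : A → B → Set} (R? : ∀ x y → Dec (R x y)) xs ys →
  length (filter (λ p → R? (proj₁ p) (proj₂ p)) (cartesianProduct xs ys)) ≡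
  sum (map (λ x → length (filter (R? x) ys)) xs)
length-filter-cartesianProduct R? []       ys = refl
length-filter-cartesianProduct R? (x ∷ xs) ys = begin
  length (filter R?′ (map (x ,_) ys ++ cartesianProduct xs ys))
    ≡⟨ cong length (filter-++ R?′ (map (x ,_) ys) (cartesianProduct xs ys)) ⟩
  length (filter R?′ (map (x ,_) ys) ++ filter R?′ (cartesianProduct xs ys))
    ≡⟨ length-++ (filter R?′ (map (x ,_) ys)) ⟩
  length (filter R?′ (map (x ,_) ys)) + length (filter R?′ (cartesianProduct xs ys))
    ≡⟨ cong₂ _+_ (length-filter-map R?′ (x ,_) ys) (length-filter-cartesianProduct R? xs ys) ⟩
  length (filter (R? x) ys) + sum (map (λ x → length (filter (R? x) ys)) xs) ∎
  where
  open ≡-Reasoning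
  R?′ = λ p → R? (proj₁ p) (proj₂ p)

+/1-mono-≤ : ∀ {m k} → m ≤ k → + m /ℚ 1 ≤ℚ + k /ℚ 1
+/1-mono-≤ {m} {k} m≤k rewrite ℚ.normalize-coprime (Coprimality.sym (1-coprimeTo m))
                            | ℚ.normalize-coprime (Coprimality.sym (1-coprimeTo k)) =
  *≤* (ℤ.*-monoʳ-≤-nonNeg (+ 1) (+≤+ m≤k))

edgesVia : (Subset n → Subset n) → List (Subset n) → List (Subset n × Subset n)
edgesVia f 𝒜 = filter (λ e → hamming (f (proj₁ e)) (f (proj₂ e)) ≟ 1) (cartesianProduct 𝒜 𝒜)

degreeSum≡length-edgesVia-id : ∀ (𝒜 : List (Subset n)) → degreeSum 𝒜 ≡ length (edgesVia id 𝒜)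
degreeSum≡length-edgesVia-id 𝒜 = sym (length-filter-cartesianProduct (λ x y → hamming x y ≟ 1) 𝒜 𝒜)

degreeSum-map : ∀ (f : Subset n → Subset n) 𝒜 → degreeSum (map f 𝒜) ≡ length (edgesVia f 𝒜)
degreeSum-map f 𝒜 = begin
  sum (map (degree (map f 𝒜)) (map f 𝒜))
    ≡⟨ cong sum (map-∘ 𝒜) ⟨
  sum (map (degree (map f 𝒜) ∘ f) 𝒜)
    ≡⟨ cong sum (map-cong (λ x → length-filter-map (λ B → hamming (f x) B ≟ 1) f 𝒜) 𝒜) ⟩
  sum (map (λ x → length (filter (λ y → hamming (f x) (f y) ≟ 1) 𝒜)) 𝒜)
    ≡⟨ length-filter-cartesianProduct (λ x y → hamming (f x) (f y) ≟ 1) 𝒜 𝒜 ⟨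
  length (edgesVia f 𝒜) ∎
  where open ≡-Reasoning

AvgDegreeAtLeast-mono : ∀ (𝒜 ℬ : List (Subset n)) d → length 𝒜 ≡ length ℬ →
                        degreeSum 𝒜 ≤ degreeSum ℬ →
                        AvgDegreeAtLeast 𝒜 d → AvgDegreeAtLeast ℬ d
AvgDegreeAtLeast-mono _ _ _ |𝒜|≡|ℬ| le avg rewrite |𝒜|≡|ℬ| = ℚ.≤-trans avg (+/1-mono-≤ le)

module Compression (𝒜 : List (Subset n)) (i : Fin n) where

  open DecMembership (_≟ˢ_ {n}) using (_∈?_)

  private variable
    A B A′ B′ : Subset n

  stays : Subset n → Bool
  stays A = does (Cᵢ i A ∈? 𝒜)

  compressed : Subset n → Subset n
  compressed A = if stays A then A else Cᵢ i A

  stays⇒Cᵢ∈ : stays A ≡ true → Cᵢ i A ∈ 𝒜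
  stays⇒Cᵢ∈ {A} st with Cᵢ i A ∈? 𝒜
  ... | yes Cᵢ∈ = Cᵢ∈

  moves⇒Cᵢ∉ : stays A ≡ false → Cᵢ i A ∉ 𝒜
  moves⇒Cᵢ∉ {A} mv with Cᵢ i A ∈? 𝒜
  ... | no Cᵢ∉ = Cᵢ∉

  compressed-stay : stays A ≡ true → compressed A ≡ A
  compressed-stay st rewrite st = refl

  compressed-move : stays A ≡ false → compressed A ≡ Cᵢ i A
  compressed-move mv rewrite mv = refl

  stays⇒Cᵢ-stays : stays A ≡ true → stays (Cᵢ i A) ≡ true
  stays⇒Cᵢ-stays {A} st =
    dec-true (Cᵢ i (Cᵢ i A) ∈? 𝒜) (subst (_∈ 𝒜) (sym (p─q─q≡p─q A ⁅ i ⁆)) (stays⇒Cᵢ∈ st))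

  moves⇒i∈ : A ∈ 𝒜 → stays A ≡ false → i ∈ˢ A
  moves⇒i∈ {A} A∈𝒜 mv with i ∈ˢ? A
  ... | yes i∈A = i∈A
  ... | no  i∉A = ⊥-elim (moves⇒Cᵢ∉ mv (subst (_∈ 𝒜) (sym (x∉p⇒p-x≡p i∉A)) A∈𝒜))

  Edge : Subset n → Subset n → Set
  Edge A B = A ∈ 𝒜 × B ∈ 𝒜 × hamming A B ≡ 1

  Edge-sym : Edge A B → Edge B A
  Edge-sym {A} {B} (A∈𝒜 , B∈𝒜 , adj) = B∈𝒜 , A∈𝒜 , trans (hamming-sym B A) adj

  -- If the neighbour B of a moving A missed i, it would be A - i ∈ 𝒜 and A could not move.
  Edge∧moves⇒i∈ : Edge A B → stays A ≡ false → i ∈ˢ A × i ∈ˢ B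
  Edge∧moves⇒i∈ {A} {B} (A∈𝒜 , B∈𝒜 , adj) mv with i ∈ˢ? B
  ... | yes i∈B = moves⇒i∈ A∈𝒜 mv , i∈B
  ... | no  i∉B = ⊥-elim (moves⇒Cᵢ∉ mv
                    (subst (_∈ 𝒜) (x∈p∧x∉q∧hamming[p,q]≡1⇒q≡p-x (moves⇒i∈ A∈𝒜 mv) i∉B adj) B∈𝒜))

  Edge∧¬both-stay⇒i∈ : Edge A B → stays A ∧ stays B ≡ false → i ∈ˢ A × i ∈ˢ B
  Edge∧¬both-stay⇒i∈ {A} {B} e ¬both with stays A in sA
  ... | false = Edge∧moves⇒i∈ e sA
  ... | true  = swap (Edge∧moves⇒i∈ (Edge-sym e) ¬both)

  lowered : Subset n → Subset n → Bool
  lowered B A = stays A ∧ not (stays B)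

  reroute : Subset n → Subset n → Subset n
  reroute B A = if lowered B A then Cᵢ i A else A

  lowered-cong : stays A′ ≡ stays A → stays B′ ≡ stays B → lowered B′ A′ ≡ lowered B A
  lowered-cong = cong₂ (λ a b → a ∧ not b)

  reroute-lowered : lowered B A ≡ true → reroute B A ≡ Cᵢ i A
  reroute-lowered low rewrite low = refl

  reroute-kept : lowered B A ≡ false → reroute B A ≡ A
  reroute-kept kept rewrite kept = refl

  reroute-∈ : A ∈ 𝒜 → reroute B A ∈ 𝒜
  reroute-∈ {A} {B} A∈𝒜 with stays A in sA | stays B
  ... | true  | false = stays⇒Cᵢ∈ sA
  ... | true  | true  = A∈𝒜
  ... | false | _     = A∈𝒜

  stays-reroute : ∀ B A → stays (reroute B A) ≡ stays A
  stays-reroute B A with stays A in sA | stays B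
  ... | true  | false = stays⇒Cᵢ-stays sA
  ... | true  | true  = sA
  ... | false | _     = sA

  compressed-reroute-stay : stays A ∧ stays B ≡ true → compressed (reroute B A) ≡ A
  compressed-reroute-stay {A} {B} both with stays A in sA | stays B
  ... | true | true = compressed-stay sA

  compressed-reroute-move : stays A ∧ stays B ≡ false → compressed (reroute B A) ≡ Cᵢ i A
  compressed-reroute-move {A} {B} ¬both with stays A in sA | stays B
  ... | true  | false = compressed-stay (stays⇒Cᵢ-stays sA)
  ... | false | _     = compressed-move sA

  reroute-adjacent : Edge A B → hamming (compressed (reroute B A)) (compressed (reroute A B)) ≡ 1
  reroute-adjacent {A} {B} e@(_ , _ , adj) with stays A ∧ stays B in both
  ... | true  = subst₂ (λ U V → hamming U V ≡ 1)
                  (sym (compressed-reroute-stay both))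
                  (sym (compressed-reroute-stay (trans (∧-comm (stays B) (stays A)) both)))
                  adj
  ... | false = begin
    hamming (compressed (reroute B A)) (compressed (reroute A B))
      ≡⟨ cong₂ hamming (compressed-reroute-move both)
                       (compressed-reroute-move (trans (∧-comm (stays B) (stays A)) both)) ⟩
    hamming (Cᵢ i A) (Cᵢ i B)
      ≡⟨ x∈p∧x∈q⇒hamming[p-x,q-x]≡hamming[p,q] i∈A i∈B ⟩
    hamming A B
      ≡⟨ adj ⟩
    1 ∎
    where
    open ≡-Reasoning
    i∈A,B = Edge∧¬both-stay⇒i∈ e both
    i∈A = proj₁ i∈A,B
    i∈B = proj₂ i∈A,B

  lowered⇒i∈ : Edge A B → lowered B A ≡ true → i ∈ˢ A
  lowered⇒i∈ {A} {B} e low with stays A | stays B in sB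
  ... | true | false = proj₂ (Edge∧moves⇒i∈ (Edge-sym e) sB)

  reroute-injective : Edge A B → Edge A′ B′ → stays A′ ≡ stays A → stays B′ ≡ stays B →
                      reroute B A ≡ reroute B′ A′ → A ≡ A′
  reroute-injective {A} {B} {A′} {B′} e e′ sA sB eq with lowered B A in low
  ... | true  = p-x-injective (lowered⇒i∈ e low) (lowered⇒i∈ e′ low′) (trans eq (reroute-lowered low′))
    where low′ = trans (lowered-cong sA sB) low
  ... | false = trans eq (reroute-kept low′)
    where low′ = trans (lowered-cong sA sB) low

  rerouteEdge : Subset n × Subset n → Subset n × Subset n
  rerouteEdge (A , B) = reroute B A , reroute A B

  edges : List (Subset n × Subset n)
  edges = edgesVia id 𝒜

  ∈-edges⁻ : (A , B) ∈ edges → Edge A B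
  ∈-edges⁻ AB∈ with AB∈𝒜² , adj ← ∈-filter⁻ _ AB∈ with A∈𝒜 , B∈𝒜 ← ∈-cartesianProduct⁻ 𝒜 𝒜 AB∈𝒜² =
    A∈𝒜 , B∈𝒜 , adj

  rerouteEdge-∈ : (A , B) ∈ edges → rerouteEdge (A , B) ∈ edgesVia compressed 𝒜
  rerouteEdge-∈ AB∈ with e@(A∈𝒜 , B∈𝒜 , _) ← ∈-edges⁻ AB∈ =
    ∈-filter⁺ _ (∈-cartesianProduct⁺ (reroute-∈ A∈𝒜) (reroute-∈ B∈𝒜)) (reroute-adjacent e)

  rerouteEdge-injective : (A , B) ∈ edges → (A′ , B′) ∈ edges →
                          rerouteEdge (A , B) ≡ rerouteEdge (A′ , B′) → (A , B) ≡ (A′ , B′)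
  rerouteEdge-injective {A} {B} {A′} {B′} AB∈ AB′∈ eq =
    cong₂ _,_ (reroute-injective e e′ sA sB (cong proj₁ eq))
              (reroute-injective (Edge-sym e) (Edge-sym e′) sB sA (cong proj₂ eq))
    where
    e = ∈-edges⁻ AB∈
    e′ = ∈-edges⁻ AB′∈
    sA : stays A′ ≡ stays A
    sA = trans (sym (stays-reroute B′ A′)) (trans (cong stays (sym (cong proj₁ eq))) (stays-reroute B A))
    sB : stays B′ ≡ stays B
    sB = trans (sym (stays-reroute A′ B′)) (trans (cong stays (sym (cong proj₂ eq))) (stays-reroute A B))

  degreeSum-compress-≥ : Unique 𝒜 → degreeSum 𝒜 ≤ degreeSum (compress i 𝒜)
  degreeSum-compress-≥ uniq = begin
    degreeSum 𝒜                       ≡⟨ degreeSum≡length-edgesVia-id 𝒜 ⟩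
    length edges                      ≤⟨ injection⇒length-≤ rerouteEdge
                                           (Unique.filter⁺ _ (Unique.cartesianProduct⁺ uniq uniq))
                                           rerouteEdge-∈ rerouteEdge-injective ⟩
    length (edgesVia compressed 𝒜)    ≡⟨ degreeSum-map compressed 𝒜 ⟨
    degreeSum (compress i 𝒜)          ∎
    where open ≤-Reasoning

  module _ {k : ℕ} (diam : DiameterBelow 𝒜 k) where

    moves∧stays⇒hamming< : A ∈ 𝒜 → B ∈ 𝒜 → stays A ≡ false → stays B ≡ true →
                           hamming (Cᵢ i A) B < k
    moves∧stays⇒hamming< {A} {B} A∈𝒜 B∈𝒜 mv st with i ∈ˢ? B
    ... | yes i∈B = subst (_< k) (sym (x∈p∧x∈q⇒hamming[p-x,q]≡hamming[p,q-x] (moves⇒i∈ A∈𝒜 mv) i∈B))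
                      (diam A∈𝒜 (stays⇒Cᵢ∈ st))
    ... | no  i∉B = ≤-<-trans (x∉q⇒hamming[p-x,q]≤hamming[p,q] {p = A} i∉B) (diam A∈𝒜 B∈𝒜)

    compressed-hamming< : A ∈ 𝒜 → B ∈ 𝒜 → hamming (compressed A) (compressed B) < k
    compressed-hamming< {A} {B} A∈𝒜 B∈𝒜 with stays A in sA | stays B in sB
    ... | true  | true  = diam A∈𝒜 B∈𝒜
    ... | false | true  = moves∧stays⇒hamming< A∈𝒜 B∈𝒜 sA sB
    ... | true  | false = subst (_< k) (hamming-sym (Cᵢ i B) A) (moves∧stays⇒hamming< B∈𝒜 A∈𝒜 sB sA)
    ... | false | false = subst (_< k)
      (sym (x∈p∧x∈q⇒hamming[p-x,q-x]≡hamming[p,q] (moves⇒i∈ A∈𝒜 sA) (moves⇒i∈ B∈𝒜 sB)))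
      (diam A∈𝒜 B∈𝒜)

    compress-DiameterBelow : DiameterBelow (compress i 𝒜) k
    compress-DiameterBelow A′∈ B′∈
      with A , A∈𝒜 , refl ← ∈-map⁻ compressed A′∈
         | B , B∈𝒜 , refl ← ∈-map⁻ compressed B′∈ = compressed-hamming< A∈𝒜 B∈𝒜

lemma1 : (n : ℕ) (𝒜 : List (Subset n)) → Unique 𝒜 → (i : Fin n) (d : ℚ) (k : ℕ)
    → AvgDegreeAtLeast 𝒜 d → DiameterBelow 𝒜 k
    → AvgDegreeAtLeast (compress i 𝒜) d × DiameterBelow (compress i 𝒜) k
lemma1 n 𝒜 uniq i d k avg diam =
  AvgDegreeAtLeast-mono 𝒜 (compress i 𝒜) d (sym (length-map _ 𝒜)) (degreeSum-compress-≥ uniq) avg ,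
  compress-DiameterBelow diam
  where open Compression 𝒜 i
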